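{- For $x \in \mathbb{C}$ and $n\in\mathbb{N}_0$, $$\sum_{k=1}^n k^2 H_k(x) = \frac{x(x+1)(2x+1) + n(n+1)(2n+1)}{6} H_n(x) - \frac{(12x^2 + 12x - 6xn + 4n^2 - 3n - 1)n}{36}.$$
   Context: For $x\in\mathbb{C}$ and $n\in\mathbb{N}_0$, $H_0(x)=0$ and $H_n(x)=\sum_{k=1}^n \frac{1}{x+k}$ for $n\ge 1$ (defined whenever $x$ is not one of $-1,\dots,-n$). -}

module Defs where

open import Level using (Level; _⊔_) renaming (suc to lsuc)
open import Data.Nat using (ℕ; zero; suc)
open import Algebra.Bundles using (CommutativeRing)
open import Relation.Nullary using (¬_)

-- A field of characteristic zero, presented as a commutative ring with a
-- (total) inversion map that is a genuine inverse on every nonzero element,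
-- and in which no positive integer n·1 vanishes.  ℂ is an instance.
module _ {c ℓ : Level} (R : CommutativeRing c ℓ) where
  open CommutativeRing R

  fromℕ : ℕ → Carrier
  fromℕ zero    = 0#
  fromℕ (suc n) = 1# + fromℕ n

record CharZeroField (c ℓ : Level) : Set (lsuc (c ⊔ ℓ)) where
  field
    commutativeRing : CommutativeRing c ℓ
  open CommutativeRing commutativeRing public
  field
    _⁻¹       : Carrier → Carrier
    ⁻¹-inverse : ∀ y → ¬ (y ≈ 0#) → (y * (y ⁻¹)) ≈ 1#
    charZero  : ∀ m → ¬ (fromℕ commutativeRing (suc m) ≈ 0#)

  ⟦_⟧ : ℕ → Carrier
  ⟦ n ⟧ = fromℕ commutativeRing n

  H : ℕ → Carrier → Carrier
  H zero    x = 0#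
  H (suc n) x = H n x + ((x + ⟦ suc n ⟧) ⁻¹)

  Σk²H : ℕ → Carrier → Carrier
  Σk²H zero    x = 0#
  Σk²H (suc n) x = Σk²H n x + ((⟦ suc n ⟧ * ⟦ suc n ⟧) * H (suc n) x)

module Submission where

-- Write P(m) = x(x+1)(2x+1) + m(m+1)(2m+1) and
-- Q(m) = (12x² + 12x − 6xm + 4m² − 3m − 1)m, so the claim is
--   Σ_{k≤n} k² H_k(x) = G(n) := P(n)/6 · H_n(x) − Q(n)/36.
-- Both sides vanish at n = 0, so it suffices that G telescopes:
-- G(n+1) − G(n) = (n+1)² H_{n+1}(x).  This rests on three polynomial
-- identities, with D(m) = 2x² − 2xm + x + 2m² + m:
--   P(m+1) = P(m) + 6(m+1)²,   Q(m+1) = Q(m) + 6D(m),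
--   P(m) = (x+m+1) D(m).
-- Given these, and 1/6, 1/36, 1/(x+n+1) being genuine inverses, the
-- step G(n) ↦ G(n+1) is a ring computation.

open import Level using (Level)
open import Function using (_∘_)
open import Data.Nat as ℕ using (ℕ; zero; suc; _≤_; s≤s; z≤n)
import Data.Nat.Properties as ℕP
open import Data.Integer as ℤ using (ℤ; +_; -[1+_])
import Data.Integer.Properties as ℤP
import Data.Maybe as Maybe
open import Relation.Nullary using (¬_)
open import Relation.Binary.Consequences using (dec⇒weaklyDec)
open import Relation.Binary.PropositionalEquality as ≡ using (_≡_)
open import Algebra.Bundles using (RawRing; CommutativeRing)
open import Algebra.Solver.Ring.AlmostCommutativeRing
  using (_-Raw-AlmostCommutative⟶_; fromCommutativeRing)

open import Defs

-- The integers map into every commutative ring; with this morphism the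
-- standard ring solver decides identities with integer coefficients.
module IntegerCoefficients {c ℓ : Level} (R : CommutativeRing c ℓ) where
  open CommutativeRing R
  open import Algebra.Properties.Ring ring using (-‿distribˡ-*; -‿distribʳ-*)
  open import Algebra.Properties.AbelianGroup +-abelianGroup
    using (⁻¹-involutive; ε⁻¹≈ε; ⁻¹-∙-comm)
  open import Algebra.Properties.Semiring.Mult semiring using (_×_; ×-homo-+; ×1-homo-*)
  open import Relation.Binary.Reasoning.Setoid setoid

  -- fromℕ is the multiple n × 1#, so it inherits the library's laws.
  fromℕ≡× : ∀ n → fromℕ R n ≡ n × 1#
  fromℕ≡× zero    = ≡.refl
  fromℕ≡× (suc n) = ≡.cong (_+_ 1#) (fromℕ≡× n)

  fromℕ-+ : ∀ m n → fromℕ R (m ℕ.+ n) ≈ fromℕ R m + fromℕ R n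
  fromℕ-+ m n
    rewrite fromℕ≡× (m ℕ.+ n) | fromℕ≡× m | fromℕ≡× n = ×-homo-+ 1# m n

  fromℕ-* : ∀ m n → fromℕ R (m ℕ.* n) ≈ fromℕ R m * fromℕ R n
  fromℕ-* m n
    rewrite fromℕ≡× (m ℕ.* n) | fromℕ≡× m | fromℕ≡× n = ×1-homo-* m n

  ι : ℤ → Carrier
  ι (+ n)    = fromℕ R n
  ι -[1+ n ] = - fromℕ R (suc n)

  cancel-1# : ∀ a b → (1# + a) + - (1# + b) ≈ a + - b
  cancel-1# a b = begin
    (1# + a) + - (1# + b)    ≈⟨ +-cong (+-comm 1# a) (sym (⁻¹-∙-comm 1# b)) ⟩
    (a + 1#) + (- 1# + - b)  ≈⟨ +-assoc a 1# _ ⟩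
    a + (1# + (- 1# + - b))  ≈⟨ +-congˡ (sym (+-assoc 1# (- 1#) (- b))) ⟩
    a + ((1# + - 1#) + - b)  ≈⟨ +-congˡ (+-congʳ (-‿inverseʳ 1#)) ⟩
    a + (0# + - b)           ≈⟨ +-congˡ (+-identityˡ (- b)) ⟩
    a + - b                  ∎

  ⊖-hom : ∀ m n → ι (m ℤ.⊖ n) ≈ fromℕ R m + - fromℕ R n
  ⊖-hom zero    zero    = sym (trans (+-identityˡ _) ε⁻¹≈ε)
  ⊖-hom (suc m) zero    = sym (trans (+-congˡ ε⁻¹≈ε) (+-identityʳ _))
  ⊖-hom zero    (suc n) = sym (+-identityˡ _)
  ⊖-hom (suc m) (suc n) rewrite ℤP.[1+m]⊖[1+n]≡m⊖n m n =
    trans (⊖-hom m n) (sym (cancel-1# (fromℕ R m) (fromℕ R n)))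

  +-hom : ∀ i j → ι (i ℤ.+ j) ≈ ι i + ι j
  +-hom (+ m)    (+ n)    = fromℕ-+ m n
  +-hom (+ m)    -[1+ n ] = ⊖-hom m (suc n)
  +-hom -[1+ m ] (+ n)    = trans (⊖-hom n (suc m)) (+-comm _ _)
  +-hom -[1+ m ] -[1+ n ] = begin
    - fromℕ R (suc (suc (m ℕ.+ n)))
      ≡⟨ ≡.cong (λ k → - fromℕ R (suc k)) (≡.sym (ℕP.+-suc m n)) ⟩
    - fromℕ R (suc m ℕ.+ suc n)             ≈⟨ -‿cong (fromℕ-+ (suc m) (suc n)) ⟩
    - (fromℕ R (suc m) + fromℕ R (suc n))   ≈⟨ sym (⁻¹-∙-comm _ _) ⟩
    - fromℕ R (suc m) + - fromℕ R (suc n)   ∎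

  neg-hom : ∀ i → ι (ℤ.- i) ≈ - ι i
  neg-hom (+ zero)  = sym ε⁻¹≈ε
  neg-hom (+ suc n) = refl
  neg-hom -[1+ n ]  = sym (⁻¹-involutive _)

  +*-hom : ∀ m j → ι (+ m ℤ.* j) ≈ fromℕ R m * ι j
  +*-hom m (+ n) = trans (reflexive (≡.cong ι (ℤP.+◃n≡+n (m ℕ.* n)))) (fromℕ-* m n)
  +*-hom m -[1+ n ] = begin
    ι (+ m ℤ.* -[1+ n ])             ≡⟨ ≡.cong ι (≡.sym (ℤP.neg-distribʳ-* (+ m) (+ suc n))) ⟩
    ι (ℤ.- (+ m ℤ.* + suc n))        ≈⟨ neg-hom (+ m ℤ.* + suc n) ⟩
    - ι (+ m ℤ.* + suc n)            ≈⟨ -‿cong (+*-hom m (+ suc n)) ⟩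
    - (fromℕ R m * fromℕ R (suc n))  ≈⟨ -‿distribʳ-* _ _ ⟩
    fromℕ R m * - fromℕ R (suc n)    ∎

  *-hom : ∀ i j → ι (i ℤ.* j) ≈ ι i * ι j
  *-hom (+ m)    j = +*-hom m j
  *-hom -[1+ m ] j = begin
    ι (-[1+ m ] ℤ.* j)            ≡⟨ ≡.cong ι (≡.sym (ℤP.neg-distribˡ-* (+ suc m) j)) ⟩
    ι (ℤ.- (+ suc m ℤ.* j))       ≈⟨ neg-hom (+ suc m ℤ.* j) ⟩
    - ι (+ suc m ℤ.* j)           ≈⟨ -‿cong (+*-hom (suc m) j) ⟩
    - (fromℕ R (suc m) * ι j)     ≈⟨ -‿distribˡ-* _ _ ⟩
    - fromℕ R (suc m) * ι j       ∎

  ℤ⟶R : ℤ.+-*-rawRing -Raw-AlmostCommutative⟶ fromCommutativeRing R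
  ℤ⟶R = record
    { ⟦_⟧ = ι ; +-homo = +-hom ; *-homo = *-hom ; -‿homo = neg-hom
    ; 0-homo = refl ; 1-homo = +-identityʳ 1# }

  open import Algebra.Solver.Ring ℤ.+-*-rawRing (fromCommutativeRing R) ℤ⟶R
    (λ a b → Maybe.map (reflexive ∘ ≡.cong ι) (dec⇒weaklyDec ℤ._≟_ a b))
    public using (Polynomial; con; _:^_; _:+_; _:*_; _:-_; :-_; solve; _:=_)

  -- The unit polynomial: con 1 raised to the 0th power, whose value is
  -- literally 1# (the value of con 1 itself is 1# + 0#).
  :1 : ∀ {k} → Polynomial k
  :1 = con (+ 1) :^ 0

  polynomialRing : ℕ → RawRing _ _
  polynomialRing k = record
    { Carrier = Polynomial k ; _≈_ = _≡_
    ; _+_ = _:+_ ; _*_ = _:*_ ; -_ = :-_ ; 0# = con (+ 0) ; 1# = :1 }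

module Formulas {a ℓ : Level} (A : RawRing a ℓ) (⟦_⟧ : ℕ → RawRing.Carrier A) where
  open RawRing A

  -- f(x) + f(m) with f(z) = z(z+1)(2z+1), so f(m) = 6 Σ_{k≤m} k²;
  -- it vanishes at x = −(m+1) since f(−z−1) = −f(z)
  P : Carrier → Carrier → Carrier
  P x m = ((x * (x + 1#)) * ((⟦ 2 ⟧ * x) + 1#)) + ((m * (m + 1#)) * ((⟦ 2 ⟧ * m) + 1#))

  Q : Carrier → Carrier → Carrier
  Q x m = (((((((⟦ 12 ⟧ * (x * x)) + (⟦ 12 ⟧ * x)) + (- ((⟦ 6 ⟧ * x) * m)))
            + (⟦ 4 ⟧ * (m * m))) + (- (⟦ 3 ⟧ * m))) + (- 1#)) * m)

  -- the quotient P(m) / (x + m + 1)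
  D : Carrier → Carrier → Carrier
  D x m = ((((⟦ 2 ⟧ * (x * x)) + (- (⟦ 2 ⟧ * (x * m)))) + x) + (⟦ 2 ⟧ * (m * m))) + m

module ClosedForm {c ℓ : Level} (R : CommutativeRing c ℓ) where
  open CommutativeRing R
  open IntegerCoefficients R using (polynomialRing; con; :1; _:+_; _:*_; _:-_; :-_; solve; _:=_)
  open import Algebra.Properties.Group +-group using (x≈y⇒x∙y⁻¹≈ε)
  open Formulas rawRing (fromℕ R)
  module Poly {k : ℕ} = Formulas (polynomialRing k) (λ j → con (+ j))
  open import Relation.Binary.Reasoning.Setoid setoid

  private
    ⟦_⟧ : ℕ → Carrier
    ⟦_⟧ = fromℕ R

  -- G s t x m h is the right-hand side, with s, t standing for 1/6, 1/36
  -- and h for H_m(x).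
  G : Carrier → Carrier → Carrier → Carrier → Carrier → Carrier
  G s t x m h = (P x m * s) * h + (- (Q x m * t))

  P-step : ∀ x m → P x (1# + m) ≈ P x m + ⟦ 6 ⟧ * ((1# + m) * (1# + m))
  P-step = solve 2 (λ x m →
    Poly.P x (:1 :+ m) := Poly.P x m :+ con (+ 6) :* ((:1 :+ m) :* (:1 :+ m))) refl

  -- Q's increment matches the term P(m)/(6(x+m+1)) left over from P
  Q-step : ∀ x m → Q x (1# + m) ≈ Q x m + ⟦ 6 ⟧ * D x m
  Q-step = solve 2 (λ x m → Poly.Q x (:1 :+ m) := Poly.Q x m :+ con (+ 6) :* Poly.D x m) refl

  -- the divisibility that makes that leftover term polynomial
  P-factor : ∀ x m → P x m ≈ (x + (1# + m)) * D x m
  P-factor = solve 2 (λ x m → Poly.P x m := (x :+ (:1 :+ m)) :* Poly.D x m) refl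

  G-zero : ∀ s t x → G s t x 0# 0# ≈ 0#
  G-zero = solve 3 (λ s t x →
    (Poly.P x (con (+ 0)) :* s) :* con (+ 0) :+ :- (Poly.Q x (con (+ 0)) :* t) := con (+ 0)) refl

  telescope : ∀ {P₀ P₁ Q₀ Q₁ D y k s t u} h →
    P₁ ≈ P₀ + ⟦ 6 ⟧ * (k * k) → Q₁ ≈ Q₀ + ⟦ 6 ⟧ * D → P₀ ≈ y * D →
    ⟦ 6 ⟧ * s ≈ 1# → ⟦ 36 ⟧ * t ≈ 1# → y * u ≈ 1# →
    (P₁ * s) * (h + u) + (- (Q₁ * t)) ≈ ((P₀ * s) * h + (- (Q₀ * t))) + (k * k) * (h + u)
  telescope {P₀} {P₁} {Q₀} {Q₁} {D} {y} {k} {s} {t} {u} h P-inc Q-inc P₀≈yD 6s≈1 36t≈1 yu≈1 = begin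
    (P₁ * s) * (h + u) + (- (Q₁ * t))
      ≈⟨ +-cong (*-congʳ (*-congʳ P-inc)) (-‿cong (*-congʳ Q-inc)) ⟩
    ((P₀ + ⟦ 6 ⟧ * (k * k)) * s) * (h + u) + (- ((Q₀ + ⟦ 6 ⟧ * D) * t))
      ≈⟨ expand P₀ Q₀ D y k s t u h ⟩
    rhs + (((((k * k) * (h + u) + (⟦ 6 ⟧ * t) * D) * (⟦ 6 ⟧ * s - 1#)
           + (s * u) * (P₀ - y * D)) + (D * s) * (y * u - 1#)) + (- (D * s)) * (⟦ 36 ⟧ * t - 1#))
      ≈⟨ +-congˡ (+-cong (+-cong (+-cong (annihilate 6s≈1) (annihilate P₀≈yD))
                                 (annihilate yu≈1)) (annihilate 36t≈1)) ⟩
    rhs + (((0# + 0#) + 0#) + 0#)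
      ≈⟨ +-congˡ (trans (+-identityʳ _) (trans (+-identityʳ _) (+-identityʳ _))) ⟩
    rhs + 0#
      ≈⟨ +-identityʳ rhs ⟩
    rhs ∎
    where
    rhs : Carrier
    rhs = ((P₀ * s) * h + (- (Q₀ * t))) + (k * k) * (h + u)

    annihilate : ∀ {a b c} → a ≈ b → c * (a - b) ≈ 0#
    annihilate {a} {b} {c} a≈b = trans (*-congˡ (x≈y⇒x∙y⁻¹≈ε a≈b)) (zeroʳ c)

    -- the difference of the two sides, written as a combination of the
    -- hypotheses' defects
    expand : ∀ P₀ Q₀ D y k s t u h →
      ((P₀ + ⟦ 6 ⟧ * (k * k)) * s) * (h + u) + (- ((Q₀ + ⟦ 6 ⟧ * D) * t))
      ≈ (((P₀ * s) * h + (- (Q₀ * t))) + (k * k) * (h + u))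
        + (((((k * k) * (h + u) + (⟦ 6 ⟧ * t) * D) * (⟦ 6 ⟧ * s - 1#)
           + (s * u) * (P₀ - y * D)) + (D * s) * (y * u - 1#)) + (- (D * s)) * (⟦ 36 ⟧ * t - 1#))
    expand = solve 9 (λ P₀ Q₀ D y k s t u h →
      ((P₀ :+ con (+ 6) :* (k :* k)) :* s) :* (h :+ u) :+ :- ((Q₀ :+ con (+ 6) :* D) :* t)
      := (((P₀ :* s) :* h :+ :- (Q₀ :* t)) :+ (k :* k) :* (h :+ u))
         :+ (((((k :* k) :* (h :+ u) :+ (con (+ 6) :* t) :* D) :* (con (+ 6) :* s :- :1)
            :+ (s :* u) :* (P₀ :- y :* D)) :+ (D :* s) :* (y :* u :- :1))
            :+ (:- (D :* s)) :* (con (+ 36) :* t :- :1))) refl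

  G-step : ∀ {s t u} x m h → ⟦ 6 ⟧ * s ≈ 1# → ⟦ 36 ⟧ * t ≈ 1# → (x + (1# + m)) * u ≈ 1# →
    G s t x (1# + m) (h + u) ≈ G s t x m h + ((1# + m) * (1# + m)) * (h + u)
  G-step x m h = telescope h (P-step x m) (Q-step x m) (P-factor x m)

module Summation {c ℓ : Level} (F : CharZeroField c ℓ) where
  open CharZeroField F
  open ClosedForm commutativeRing using (G; G-zero; G-step)
  open import Relation.Binary.Reasoning.Setoid setoid

  closed-form : ∀ (x : Carrier) (n : ℕ) →
    (∀ (k : ℕ) → 1 ≤ k → k ≤ n → ¬ ((x + ⟦ k ⟧) ≈ 0#)) →
    Σk²H n x ≈ G (⟦ 6 ⟧ ⁻¹) (⟦ 36 ⟧ ⁻¹) x ⟦ n ⟧ (H n x)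
  closed-form x zero    _     = sym (G-zero _ _ x)
  closed-form x (suc n) avoid = begin
    Σk²H n x + (⟦ suc n ⟧ * ⟦ suc n ⟧) * H (suc n) x
      ≈⟨ +-congʳ (closed-form x n (λ k 1≤k k≤n → avoid k 1≤k (ℕP.m≤n⇒m≤1+n k≤n))) ⟩
    G s t x ⟦ n ⟧ (H n x) + (⟦ suc n ⟧ * ⟦ suc n ⟧) * (H n x + u)
      ≈⟨ sym (G-step x ⟦ n ⟧ (H n x) (⁻¹-inverse ⟦ 6 ⟧ (charZero 5)) (⁻¹-inverse ⟦ 36 ⟧ (charZero 35))
                     (⁻¹-inverse (x + ⟦ suc n ⟧) (avoid (suc n) (s≤s z≤n) ℕP.≤-refl))) ⟩
    G s t x ⟦ suc n ⟧ (H (suc n) x) ∎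
    where
    s t u : Carrier
    s = ⟦ 6 ⟧ ⁻¹
    t = ⟦ 36 ⟧ ⁻¹
    u = (x + ⟦ suc n ⟧) ⁻¹

proposition7 : ∀ {c ℓ : Level} (F : CharZeroField c ℓ) → let open CharZeroField F in
    ∀ (x : Carrier) (n : ℕ) →
    (∀ (k : ℕ) → 1 ≤ k → k ≤ n → ¬ ((x + ⟦ k ⟧) ≈ 0#)) →
    Σk²H n x ≈
      ((((x * (x + 1#)) * ((⟦ 2 ⟧ * x) + 1#)) + ((⟦ n ⟧ * (⟦ n ⟧ + 1#)) * ((⟦ 2 ⟧ * ⟦ n ⟧) + 1#))) * (⟦ 6 ⟧ ⁻¹)) * H n x
      + (- ((((((((⟦ 12 ⟧ * (x * x)) + (⟦ 12 ⟧ * x)) + (- ((⟦ 6 ⟧ * x) * ⟦ n ⟧))) + (⟦ 4 ⟧ * (⟦ n ⟧ * ⟦ n ⟧))) + (- (⟦ 3 ⟧ * ⟦ n ⟧))) + (- 1#)) * ⟦ n ⟧) * (⟦ 36 ⟧ ⁻¹)))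
proposition7 F = Summation.closed-form F
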